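{- Let $n\ge 2$ and $m\ge 1$ be integers. Let $B'_n=\{(1,1,1,\ldots,1),(1,2,1,\ldots,1),(1,1,2,\ldots,1),\ldots,(1,1,\ldots,1,2)\}\subset\mathbb{Z}^n$, i.e. $B'_n$ consists of the all-ones vector $\mathbf j\in\mathbb{Z}^n$ together with the vectors $\mathbf j+\mathbf e_i$ for $i=2,\ldots,n$, viewed as elements of the group $\Gamma=\mathbb{Z}_m\oplus\mathbb{Z}_{m(n+1)}\oplus\cdots\oplus\mathbb{Z}_{m(n+1)}$ (with $n-1$ summands $\mathbb{Z}_{m(n+1)}$), where the first coordinate is read modulo $m$ and the others modulo $m(n+1)$. Then the Cayley digraph $D_{n,m}=\mathrm{Cay}(\Gamma;B'_n)$ has diameter $\binom{n+1}{2}m-n$.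
   Context: For an Abelian group $\Gamma$ and a generating set $A\subseteq\Gamma$, the Cayley digraph $\mathrm{Cay}(\Gamma;A)$ has vertex set $\Gamma$ and an arc $(u,v)$ if and only if $v-u\in A$. Its diameter is the maximum, over ordered pairs of vertices $(u,v)$, of the length of a shortest directed path from $u$ to $v$. $\mathbb{Z}_t$ denotes the cyclic group of integers modulo $t$. -}

module Defs where

open import Data.Nat using (ℕ; zero; suc; _*_; _∸_; _≤_)
open import Data.Nat.DivMod using (_mod_)
open import Data.Fin using (Fin; toℕ)
open import Data.Fin.Properties using (_≟_)
open import Data.Maybe using (Maybe; just; nothing)
open import Data.Vec using (Vec; zipWith; tabulate)
open import Data.Product using (Σ; ∃; _×_; _,_)
open import Relation.Binary.PropositionalEquality using (_≡_)
open import Relation.Nullary using (does)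
open import Data.Bool using (if_then_else_)
import Data.Nat as N

addₘ : ∀ {t} → Fin t → ℕ → Fin t
addₘ {suc t} a k = (toℕ a N.+ k) mod suc t

-- The group Γ = ℤ_m ⊕ ℤ_{m(n+1)}^{n-1}: first coordinate mod m,
-- remaining n-1 coordinates (original coordinates 2..n) mod m(n+1).
Γ : ℕ → ℕ → Set
Γ n m = Fin m × Vec (Fin (m * suc n)) (n ∸ 1)

-- Integer vectors in ℤ^n with nonnegative entries, split as (first coord, coords 2..n).
IntVec : ℕ → Set
IntVec n = ℕ × Vec ℕ (n ∸ 1)

_⊞_ : ∀ {n m} → Γ n m → IntVec n → Γ n m
(a , xs) ⊞ (b , ys) = addₘ a b , zipWith addₘ xs ys

-- Elements of B'_n ⊂ ℤ^n, indexed by Maybe (Fin (n-1)):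
--   nothing  ↦ j = (1,1,...,1)
--   just k   ↦ j + e_{k+2}   (1-based coordinate k+2 ∈ {2,...,n})
gen : ∀ n → Maybe (Fin (n ∸ 1)) → IntVec n
gen n nothing  = 1 , tabulate (λ _ → 1)
gen n (just k) = 1 , tabulate (λ j → if does (k ≟ j) then 2 else 1)

Arc : ∀ n m → Γ n m → Γ n m → Set
Arc n m u v = Σ (Maybe (Fin (n ∸ 1))) λ g → v ≡ u ⊞ gen n g
data Walk (n m : ℕ) : Γ n m → Γ n m → ℕ → Set where
  nil  : ∀ {u} → Walk n m u u 0
  cons : ∀ {u w v k} → Arc n m u w → Walk n m w v k → Walk n m u v (suc k)

HasDiameter : ℕ → ℕ → ℕ → Set
HasDiameter n m d =
  ((u v : Γ n m) → Σ ℕ λ k → k ≤ d × Walk n m u v k)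
  × (Σ (Γ n m) λ u → Σ (Γ n m) λ v → (k : ℕ) → Walk n m u v k → d ≤ k)

module Submission where

-- A walk of length k using the generator j + e_{i+1} exactly aᵢ times moves its
-- start by (k, k + a₁, …, k + a_q); so v is reachable from u in k steps iff some a ≥ 0 with
-- ∑ a ≤ k has k ≡ v₀ − u₀ (mod m) and k + aᵢ ≡ vᵢ − uᵢ (mod M)  (module Walks).
--
-- Pick K ∈ [D − (m − 1), D] in the class of v₀ − u₀ and write the least
-- solutions for K as cᵢ + m eᵢ with cᵢ < m.  Moving s multiples of m from k into every aᵢ
-- costs ∑ c + m · (s + ∑ (eᵢ + s) mod N).  The N shift costs lie in distinct classes mod N
-- and add up to Δ n + N Δ q, so one of them is at most Δ q (good-shift), giving ∑ a ≤ k.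
--
-- A walk from 0 to v* = (D, D + m − 1, D + 2m − 1, …, D + qm − 1) of length
-- k = D − G m with G ≥ 1 needs aᵢ ≥ m ((G + i) mod N) + m − 1; these q residues miss only
-- two consecutive values of a full period (partial-shift-bound), forcing k ≥ D after all.

open import Defs
open import Data.Nat using (ℕ; zero; suc; pred; NonZero; _+_; _*_; _∸_; _≤_; _<_; z≤n; s≤s; s≤s⁻¹; _%_; _/_; _≤?_; _<?_)
open import Data.Nat.Properties hiding (_≟_)
open import Data.Nat.DivMod
open import Data.Nat.Combinatorics using (_C_; nC1≡n; nCk+nC[k+1]≡[n+1]C[k+1])
open import Data.Nat.Tactic.RingSolver using (solve-∀)
open import Data.Fin using (Fin; toℕ; opposite; inject₁; fromℕ) renaming (zero to fzero; suc to fsuc)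
open import Data.Fin.Properties using (_≟_; any?; toℕ-injective; toℕ<n; toℕ-fromℕ<; toℕ-fromℕ; toℕ-inject₁; opposite-prop)
import Data.Fin.Permutation as Perm
open import Data.Maybe using (Maybe; just; nothing)
open import Data.Vec using (Vec; lookup; tabulate)
open import Data.Vec.Properties using (lookup-zipWith; lookup∘tabulate; tabulate∘lookup; tabulate-cong)
open import Data.Bool using (if_then_else_)
open import Data.Empty using (⊥)
open import Data.Product using (Σ; _×_; _,_; proj₁; proj₂)
open import Level using (0ℓ)
open import Relation.Nullary using (Dec; does; yes; no; contradiction)
open import Relation.Binary.Bundles using (Setoid)
open import Relation.Binary.PropositionalEquality
import Relation.Binary.Reasoning.Setoid as SetoidReasoning
open import Algebra.Properties.Semiring.Sum +-*-semiring
  using (sum; sum-syntax; sum-cong-≗; sum-remove; sum-init-last; sum-replicate-zero; ∑-distrib-+; ∑-comm; ∑-permute; *-distribˡ-sum)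

sum-const : ∀ L c → ∑[ i < L ] c ≡ L * c
sum-const zero    c = refl
sum-const (suc L) c = cong (c +_) (sum-const L c)

sum-mono : ∀ {L} {f g : Fin L → ℕ} → (∀ i → f i ≤ g i) → sum f ≤ sum g
sum-mono {zero}  f≤g = z≤n
sum-mono {suc L} f≤g = +-mono-≤ (f≤g fzero) (sum-mono (λ i → f≤g (fsuc i)))

term≤sum : ∀ {L} (f : Fin L → ℕ) i → f i ≤ sum f
term≤sum {suc L} f i = ≤-trans (m≤m+n (f i) _) (≤-reflexive (sym (sum-remove {i = i} f)))

-- Congruence of natural numbers: equal remainders on division by N.  A record, so that
-- the two sides stay visible to unification.
infix 4 _≡_[mod_]
record _≡_[mod_] (x y N : ℕ) .{{_ : NonZero N}} : Set where
  constructor congruent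
  field remainders : x % N ≡ y % N
open _≡_[mod_]

module _ {N : ℕ} .{{_ : NonZero N}} where

  mod-refl : ∀ {x} → x ≡ x [mod N ]
  mod-refl = congruent refl

  mod-sym : ∀ {x y} → x ≡ y [mod N ] → y ≡ x [mod N ]
  mod-sym (congruent h) = congruent (sym h)

  mod-trans : ∀ {x y z} → x ≡ y [mod N ] → y ≡ z [mod N ] → x ≡ z [mod N ]
  mod-trans (congruent h) (congruent h′) = congruent (trans h h′)

  mod-reflexive : ∀ {x y} → x ≡ y → x ≡ y [mod N ]
  mod-reflexive refl = mod-refl

  mod-setoid : Setoid 0ℓ 0ℓ
  mod-setoid = record
    { Carrier = ℕ
    ; _≈_ = _≡_[mod N ]
    ; isEquivalence = record { refl = mod-refl ; sym = mod-sym ; trans = mod-trans } }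

module ≡-mod-Reasoning (N : ℕ) .{{_ : NonZero N}} = SetoidReasoning (mod-setoid {N})

module _ {N : ℕ} .{{_ : NonZero N}} where

  mod-+ : ∀ {a a′ b b′} → a ≡ a′ [mod N ] → b ≡ b′ [mod N ] → a + b ≡ a′ + b′ [mod N ]
  mod-+ {a} {a′} {b} {b′} (congruent ha) (congruent hb) = congruent (begin
    (a + b) % N                ≡⟨ %-distribˡ-+ a b N ⟩
    (a % N + b % N) % N        ≡⟨ cong₂ (λ x y → (x + y) % N) ha hb ⟩
    (a′ % N + b′ % N) % N      ≡⟨ %-distribˡ-+ a′ b′ N ⟨
    (a′ + b′) % N              ∎)
    where open ≡-Reasoning

  mod-% : ∀ x → x % N ≡ x [mod N ]
  mod-% x = congruent (m%n%n≡m%n x N)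

  mod-multiple : ∀ x k → x + k * N ≡ x [mod N ]
  mod-multiple x k = congruent ([m+kn]%n≡m%n x k N)

  -- Adding z can be undone by adding z (N − 1), completing a multiple of N.
  mod-cancelˡ : ∀ z {x y} → z + x ≡ z + y [mod N ] → x ≡ y [mod N ]
  mod-cancelˡ z {x} {y} h = begin
    x                      ≈⟨ mod-multiple x z ⟨
    x + z * N              ≡⟨ complete x ⟩
    z + x + z * pred N     ≈⟨ mod-+ h (mod-refl {x = z * pred N}) ⟩
    z + y + z * pred N     ≡⟨ complete y ⟨
    y + z * N              ≈⟨ mod-multiple y z ⟩
    y                      ∎
    where
    open ≡-mod-Reasoning N
    expand : ∀ w z p → w + z * suc p ≡ z + w + z * p
    expand = solve-∀
    complete : ∀ w → w + z * N ≡ z + w + z * pred N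
    complete w = trans (cong (λ t → w + z * t) (sym (suc-pred N))) (expand w z (pred N))

  mod-small : ∀ {x y} → x < N → y ≡ x [mod N ] → y % N ≡ x
  mod-small x<N h = trans (remainders h) (m<n⇒m%n≡m x<N)

  least-in-class : ∀ {b x} r → b ≤ x → x ≡ b + r [mod N ] → b + r % N ≤ x
  least-in-class {b} {x} r b≤x h = begin
    b + r % N   ≡⟨ cong (b +_) (remainders (mod-cancelˡ b (mod-trans (mod-reflexive (m+[n∸m]≡n b≤x)) h))) ⟨
    b + d % N   ≤⟨ +-monoʳ-≤ b (m%n≤m d N) ⟩
    b + d       ≡⟨ m+[n∸m]≡n b≤x ⟩
    x           ∎
    where
    open ≤-Reasoning
    d = x ∸ b

  sum-% : ∀ {L} (f : Fin L → ℕ) → sum (λ i → f i % N) ≡ sum f [mod N ]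
  sum-% {zero}  f = mod-refl
  sum-% {suc L} f = mod-+ (mod-% (f fzero)) (sum-% (λ i → f (fsuc i)))

  toℕ-mod : ∀ x → toℕ (x mod N) ≡ x [mod N ]
  toℕ-mod x = mod-trans (mod-reflexive (toℕ-fromℕ< _)) (mod-% x)

-- V + U p is V − U modulo p + 1.
undo-shift : ∀ p U V → U + (V + U * p) ≡ V [mod suc p ]
undo-shift p U V = mod-trans (mod-reflexive (regroup p U V)) (mod-multiple V U)
  where
  regroup : ∀ p U V → U + (V + U * p) ≡ V + U * suc p
  regroup = solve-∀

scaled-residue : ∀ m′ n x → suc m′ * (x % suc n) ≡ suc m′ * x [mod suc m′ * suc n ]
scaled-residue m′ n x = mod-sym (mod-trans (mod-reflexive expand) (mod-multiple (m * (x % N)) (x / N)))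
  where
  m N : ℕ
  m = suc m′
  N = suc n
  distribute : ∀ m r d N → m * (r + d * N) ≡ m * r + d * (m * N)
  distribute = solve-∀
  expand : m * x ≡ m * (x % N) + x / N * (m * N)
  expand = trans (cong (m *_) (m≡m%n+[m/n]*n x N)) (distribute m (x % N) (x / N) N)

class-gap : ∀ n {k D} → k ≤ D → k ≡ D [mod suc n ] → Σ ℕ λ J → D ≡ k + J * suc n
class-gap n {k} {D} k≤D h = d / suc n , (begin
  D                                     ≡⟨ m+[n∸m]≡n k≤D ⟨
  k + d                                 ≡⟨ cong (k +_) (m≡m%n+[m/n]*n d (suc n)) ⟩
  k + (d % suc n + d / suc n * suc n)   ≡⟨ cong (λ r → k + (r + d / suc n * suc n)) d%N≡0 ⟩
  k + d / suc n * suc n                 ∎)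
  where
  open ≡-Reasoning
  d = D ∸ k
  k+d≡k+0 : k + d ≡ k + 0 [mod suc n ]
  k+d≡k+0 = mod-trans (mod-reflexive (m+[n∸m]≡n k≤D)) (mod-trans (mod-sym h) (mod-reflexive (sym (+-identityʳ k))))
  d%N≡0 : d % suc n ≡ 0
  d%N≡0 = remainders (mod-cancelˡ k k+d≡k+0)

top-representative : ∀ m′ D x → m′ ≤ D → Σ ℕ λ K → K ≤ D × D ≤ K + m′ × K ≡ x [mod suc m′ ]
top-representative m′ D x m′≤D = K , m∸n≤m D σ , D≤K+m′ , mod-cancelˡ (D + x * m′) lift
  where
  σ = (D + x * m′) % suc m′
  σ≤m′ : σ ≤ m′
  σ≤m′ = s≤s⁻¹ (m%n<n (D + x * m′) (suc m′))
  K = D ∸ σ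
  K+σ : K + σ ≡ D
  K+σ = m∸n+n≡m (≤-trans σ≤m′ m′≤D)
  D≤K+m′ : D ≤ K + m′
  D≤K+m′ = subst (_≤ K + m′) K+σ (+-monoʳ-≤ K σ≤m′)
  regroup : ∀ D x m′ → D + x * m′ + x ≡ D + x * suc m′
  regroup = solve-∀
  lift : D + x * m′ + K ≡ D + x * m′ + x [mod suc m′ ]
  lift = begin
    D + x * m′ + K      ≈⟨ mod-+ (mod-% (D + x * m′)) (mod-refl {x = K}) ⟨
    σ + K               ≡⟨ trans (+-comm σ K) K+σ ⟩
    D                   ≈⟨ mod-multiple D x ⟨
    D + x * suc m′      ≡⟨ regroup D x m′ ⟨
    D + x * m′ + x      ∎
    where open ≡-mod-Reasoning (suc m′)

cancel-remainder : ∀ m′ x y → suc m′ * x ≤ m′ + suc m′ * y → x ≤ y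
cancel-remainder m′ x y h with x ≤? y
... | yes x≤y = x≤y
... | no  x≰y = contradiction (subst (_≤ m′ + suc m′ * y) (expand m′ y) (≤-trans (*-monoʳ-≤ (suc m′) (≰⇒> x≰y)) h)) 1+n≰n
  where
  expand : ∀ m′ y → suc m′ * suc y ≡ suc (m′ + suc m′ * y)
  expand = solve-∀

-- The group ℤ_t = Fin t and the walks of the Cayley digraph.

-- Natural numbers below N are their own remainders, so congruence is equality there.
Fin-congruent : ∀ {t} {x y : Fin (suc t)} → toℕ x ≡ toℕ y [mod suc t ] → x ≡ y
Fin-congruent {t} {x} {y} (congruent h) = toℕ-injective (begin
  toℕ x            ≡⟨ m<n⇒m%n≡m (toℕ<n x) ⟨
  toℕ x % suc t    ≡⟨ h ⟩
  toℕ y % suc t    ≡⟨ m<n⇒m%n≡m (toℕ<n y) ⟩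
  toℕ y            ∎)
  where open ≡-Reasoning

addₘ-toℕ : ∀ {t} (a : Fin (suc t)) k → toℕ (addₘ a k) ≡ toℕ a + k [mod suc t ]
addₘ-toℕ {t} a k = mod-trans (mod-reflexive (toℕ-fromℕ< _)) (mod-% (toℕ a + k))

vec-ext : ∀ {A : Set} {L} {xs ys : Vec A L} → (∀ j → lookup xs j ≡ lookup ys j) → xs ≡ ys
vec-ext {xs = xs} {ys} e = trans (sym (tabulate∘lookup xs)) (trans (tabulate-cong e) (tabulate∘lookup ys))

-- The generator indexed by g is j plus the 0/1 vector bump g.
bump : ∀ {q} → Maybe (Fin q) → Fin q → ℕ
bump nothing  j = 0
bump (just i) j = if does (i ≟ j) then 1 else 0

gen-coord : ∀ q (g : Maybe (Fin q)) j → lookup (proj₂ (gen (suc q) g)) j ≡ suc (bump g j)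
gen-coord q nothing  j = lookup∘tabulate _ j
gen-coord q (just i) j = trans (lookup∘tabulate _ j) (two-or-one (i ≟ j))
  where
  two-or-one : ∀ {P : Set} (d : Dec P) → (if does d then 2 else 1) ≡ suc (if does d then 1 else 0)
  two-or-one (yes _) = refl
  two-or-one (no  _) = refl

sum-bump-just : ∀ {q} (i : Fin q) → sum (bump (just i)) ≡ 1
sum-bump-just {suc q} fzero    = cong suc (sum-replicate-zero q)
sum-bump-just         (fsuc i) = sum-bump-just i

sum-bump : ∀ {q} (g : Maybe (Fin q)) → sum (bump g) ≤ 1
sum-bump {q} nothing  = ≤-trans (≤-reflexive (sum-replicate-zero q)) z≤n
sum-bump     (just i) = ≤-reflexive (sum-bump-just i)

bump≤ : ∀ {q} (a : Fin q → ℕ) i → 0 < a i → ∀ j → bump (just i) j ≤ a j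
bump≤ a i pos j with i ≟ j
... | yes refl = pos
... | no  _    = z≤n

module Walks (q m′ : ℕ) where
  private
    n m M : ℕ
    n = suc q
    m = suc m′
    M = m * suc n

  coord : Γ n m → Fin q → ℕ
  coord (_ , us) j = toℕ (lookup us j)

  follow : Γ n m → Maybe (Fin q) → Γ n m
  follow u g = _⊞_ {n} u (gen n g)

  record Reaches (u v : Γ n m) (k : ℕ) (a : Fin q → ℕ) : Set where
    constructor reaches
    field
      first  : toℕ (proj₁ u) + k ≡ toℕ (proj₁ v) [mod m ]
      others : ∀ j → coord u j + (k + a j) ≡ coord v j [mod M ]

  -- Following the arc of generator g shifts the first coordinate by one (split on g so
  -- that gen computes) ...
  arc-first : ∀ u g k → toℕ (proj₁ (follow u g)) + k ≡ toℕ (proj₁ u) + suc k [mod m ]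
  arc-first (u₀ , _) nothing  k = mod-trans (mod-+ (addₘ-toℕ u₀ 1) mod-refl) (mod-reflexive (+-assoc (toℕ u₀) 1 k))
  arc-first (u₀ , _) (just _) k = mod-trans (mod-+ (addₘ-toℕ u₀ 1) mod-refl) (mod-reflexive (+-assoc (toℕ u₀) 1 k))

  arc-coord : ∀ u g k b j → coord (follow u g) j + (k + b) ≡ coord u j + (suc k + (bump g j + b)) [mod M ]
  arc-coord (u₀ , us) g k b j = mod-trans (mod-+ shifted mod-refl) (mod-reflexive (regroup (coord (u₀ , us) j) (bump g j) k b))
    where
    regroup : ∀ x c k b → x + suc c + (k + b) ≡ x + (suc k + (c + b))
    regroup = solve-∀
    shifted : coord (follow (u₀ , us) g) j ≡ coord (u₀ , us) j + suc (bump g j) [mod M ]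
    shifted = mod-trans (mod-reflexive (cong toℕ (trans (lookup-zipWith addₘ j us _) (cong (addₘ (lookup us j)) (gen-coord q g j)))))
                        (addₘ-toℕ (lookup us j) (suc (bump g j)))

  step⁺ : ∀ {u v k a} g → Reaches (follow u g) v k a → Reaches u v (suc k) (λ j → bump g j + a j)
  step⁺ {u} {k = k} {a} g (reaches h₀ h) =
    reaches (mod-trans (mod-sym (arc-first u g k)) h₀) λ j → mod-trans (mod-sym (arc-coord u g k (a j) j)) (h j)

  step⁻ : ∀ {u v k a} g → Reaches u v (suc k) (λ j → bump g j + a j) → Reaches (follow u g) v k a
  step⁻ {u} {k = k} {a} g (reaches h₀ h) =
    reaches (mod-trans (arc-first u g k) h₀) λ j → mod-trans (arc-coord u g k (a j) j) (h j)

  reaches-cong : ∀ {u v k a b} → (∀ j → a j ≡ b j) → Reaches u v k a → Reaches u v k b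
  reaches-cong {u} {k = k} a≗b (reaches h₀ h) =
    reaches h₀ λ j → mod-trans (mod-reflexive (cong (λ x → coord u j + (k + x)) (sym (a≗b j)))) (h j)

  reaches-refl : ∀ u → Reaches u u 0 (λ _ → 0)
  reaches-refl u = reaches (mod-reflexive (+-identityʳ _)) λ j → mod-reflexive (+-identityʳ _)

  -- The zero displacement is the identity, since coordinates are below their moduli.
  reaches-zero : ∀ {u v} → Reaches u v 0 (λ _ → 0) → u ≡ v
  reaches-zero {u₀ , us} {v₀ , vs} (reaches h₀ h) =
    cong₂ _,_ (Fin-congruent (mod-trans (mod-reflexive (sym (+-identityʳ _))) h₀))
              (vec-ext λ j → Fin-congruent (mod-trans (mod-reflexive (sym (+-identityʳ _))) (h j)))

  walk-reaches : ∀ {u v k} → Walk n m u v k → Σ (Fin q → ℕ) λ a → sum a ≤ k × Reaches u v k a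
  walk-reaches {u} nil = (λ _ → 0) , ≤-reflexive (sum-replicate-zero q) , reaches-refl u
  walk-reaches {k = suc k} (cons (g , refl) w) with walk-reaches w
  ... | a , sum≤k , r = (λ j → bump g j + a j) , bound , step⁺ g r
    where
    bound : sum (λ j → bump g j + a j) ≤ suc k
    bound = ≤-trans (≤-reflexive (∑-distrib-+ (bump g) a)) (+-mono-≤ (sum-bump g) sum≤k)

  peel : ∀ k (a : Fin q → ℕ) → sum a ≤ suc k →
         Σ (Maybe (Fin q)) λ g → Σ (Fin q → ℕ) λ a′ → (∀ j → bump g j + a′ j ≡ a j) × sum a′ ≤ k
  peel k a sum≤ with any? (λ i → 0 <? a i)
  ... | yes (i , pos) = just i , a′ , restore , s≤s⁻¹ (≤-trans (≤-reflexive total) sum≤)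
    where
    a′ : Fin q → ℕ
    a′ j = a j ∸ bump (just i) j
    restore : ∀ j → bump (just i) j + a′ j ≡ a j
    restore j = m+[n∸m]≡n (bump≤ a i pos j)
    total : suc (sum a′) ≡ sum a
    total = trans (cong (_+ sum a′) (sym (sum-bump-just i))) (trans (sym (∑-distrib-+ (bump (just i)) a′)) (sum-cong-≗ restore))
  ... | no none = nothing , a , (λ j → refl) , ≤-trans (≤-reflexive total) z≤n
    where
    total : sum a ≡ 0
    total = trans (sum-cong-≗ (λ i → n≤0⇒n≡0 (≮⇒≥ (λ pos → none (i , pos))))) (sum-replicate-zero q)

  reaches-walk : ∀ k a {u v} → sum a ≤ k → Reaches u v k a → Walk n m u v k
  reaches-walk zero a sum≤ r = subst (λ v → Walk n m _ v 0) (reaches-zero (reaches-cong zeros r)) nil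
    where
    zeros : ∀ j → a j ≡ 0
    zeros j = n≤0⇒n≡0 (≤-trans (term≤sum a j) sum≤)
  reaches-walk (suc k) a sum≤ r with peel k a sum≤
  ... | g , a′ , restore , sum≤′ =
    cons (g , refl) (reaches-walk k a′ sum≤′ (step⁻ g (reaches-cong (λ j → sym (restore j)) r)))

-- Triangular numbers, and sums of residues over a full period.

Δ : ℕ → ℕ
Δ zero    = 0
Δ (suc n) = suc n + Δ n

Δ≡C : ∀ n → suc n C 2 ≡ Δ n
Δ≡C zero    = refl
Δ≡C (suc n) = trans (sym (nCk+nC[k+1]≡[n+1]C[k+1] (suc n) 1)) (cong₂ _+_ (nC1≡n (suc n)) (Δ≡C n))

sum-toℕ : ∀ n → ∑[ s < suc n ] toℕ s ≡ Δ n
sum-toℕ zero    = refl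
sum-toℕ (suc n) = begin
  ∑[ s < suc n ] (1 + toℕ s)               ≡⟨ ∑-distrib-+ {suc n} (λ _ → 1) toℕ ⟩
  ∑[ s < suc n ] 1 + ∑[ s < suc n ] toℕ s  ≡⟨ cong₂ _+_ (trans (sum-const (suc n) 1) (*-identityʳ (suc n))) (sum-toℕ n) ⟩
  suc n + Δ n                              ∎
  where open ≡-Reasoning

sum-last : ∀ N (g : ℕ → ℕ) → ∑[ s < suc N ] g (toℕ s) ≡ ∑[ s < N ] g (toℕ s) + g N
sum-last N g = begin
  ∑[ s < suc N ] g (toℕ s)                              ≡⟨ sum-init-last {N} (λ s → g (toℕ s)) ⟩
  ∑[ s < N ] g (toℕ (inject₁ s)) + g (toℕ (fromℕ N))
    ≡⟨ cong₂ _+_ (sum-cong-≗ {N} (λ s → cong g (toℕ-inject₁ s))) (cong g (toℕ-fromℕ N)) ⟩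
  ∑[ s < N ] g (toℕ s) + g N                            ∎
  where open ≡-Reasoning

sum-rotate : ∀ N (g : ℕ → ℕ) → g N ≡ g 0 → ∑[ s < N ] g (suc (toℕ s)) ≡ ∑[ s < N ] g (toℕ s)
sum-rotate N g periodic = +-cancelˡ-≡ (g 0) _ _ (begin
  g 0 + ∑[ s < N ] g (suc (toℕ s))   ≡⟨ sum-last N g ⟩
  ∑[ s < N ] g (toℕ s) + g N         ≡⟨ cong (∑[ s < N ] g (toℕ s) +_) periodic ⟩
  ∑[ s < N ] g (toℕ s) + g 0         ≡⟨ +-comm _ (g 0) ⟩
  g 0 + ∑[ s < N ] g (toℕ s)         ∎)
  where open ≡-Reasoning

-- The residues of c, c + 1, …, c + n modulo n + 1 are 0, 1, …, n in some order.
shift-sum : ∀ n c → ∑[ s < suc n ] ((c + toℕ s) % suc n) ≡ Δ n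
shift-sum n zero    = trans (sum-cong-≗ {suc n} (λ s → m<n⇒m%n≡m (toℕ<n s))) (sum-toℕ n)
shift-sum n (suc c) = begin
  ∑[ s < suc n ] ((suc c + toℕ s) % suc n)     ≡⟨ sum-cong-≗ {suc n} (λ s → cong (_% suc n) (sym (+-suc c (toℕ s)))) ⟩
  ∑[ s < suc n ] ((c + suc (toℕ s)) % suc n)   ≡⟨ sum-rotate (suc n) (λ t → (c + t) % suc n) periodic ⟩
  ∑[ s < suc n ] ((c + toℕ s) % suc n)         ≡⟨ shift-sum n c ⟩
  Δ n                                        ∎
  where
  open ≡-Reasoning
  periodic : (c + suc n) % suc n ≡ (c + 0) % suc n
  periodic = trans ([m+n]%n≡m%n c (suc n)) (cong (_% suc n) (sym (+-identityʳ c)))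

sum-reverse : ∀ {N} (f : Fin N → ℕ) → ∑[ s < N ] f (opposite s) ≡ sum f
sum-reverse f = sym (∑-permute f Perm.reverse)

-- If f s + s is constant modulo N = n + 1, the values of f fill all residue classes,
-- so above a common lower bound b they sum to at least N * b + (0 + 1 + ⋯ + n).
residue-sum-bound : ∀ n (f : Fin (suc n) → ℕ) c b →
  (∀ s → f s + toℕ s ≡ c [mod suc n ]) → (∀ s → b ≤ f s) → suc n * b + Δ n ≤ sum f
residue-sum-bound n f c b constant above = begin
  suc n * b + Δ n                          ≡⟨ cong₂ _+_ (sum-const (suc n) b) residues ⟨
  ∑[ s < suc n ] b + ∑[ s < suc n ] r s    ≡⟨ ∑-distrib-+ {suc n} (λ _ → b) r ⟨
  ∑[ s < suc n ] (b + r s)                 ≤⟨ sum-mono (λ s → least-in-class (R + toℕ (opposite s)) (above s) (class s)) ⟩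
  sum f                                    ∎
  where
  open ≤-Reasoning
  -- f s − b lies in the class of R + (n − s); these classes are a reversed period.
  R = c + suc (b * n)
  r : Fin (suc n) → ℕ
  r s = (R + toℕ (opposite s)) % suc n
  residues : ∑[ s < suc n ] r s ≡ Δ n
  residues = trans (sum-reverse (λ s → (R + toℕ s) % suc n)) (shift-sum n R)
  reach-c : ∀ s → toℕ s + (b + (R + toℕ (opposite s))) ≡ c + suc b * suc n
  reach-c s = begin-equality
    toℕ s + (b + (R + toℕ (opposite s)))  ≡⟨ cong (λ d → toℕ s + (b + (R + d))) (opposite-prop s) ⟩
    x + (b + (c + suc (b * n) + d))       ≡⟨ cong (λ t → x + (b + (c + suc (b * t) + d))) (sym x+d) ⟩
    x + (b + (c + suc (b * (x + d)) + d)) ≡⟨ expand x b c d ⟩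
    c + suc b * suc (x + d)               ≡⟨ cong (λ t → c + suc b * suc t) x+d ⟩
    c + suc b * suc n                     ∎
    where
    x = toℕ s
    d = n ∸ x
    x+d : x + d ≡ n
    x+d = m+[n∸m]≡n (s≤s⁻¹ (toℕ<n s))
    expand : ∀ x b c d → x + (b + (c + suc (b * (x + d)) + d)) ≡ c + suc b * suc (x + d)
    expand = solve-∀
  class : ∀ s → f s ≡ b + (R + toℕ (opposite s)) [mod suc n ]
  class s = mod-cancelˡ (toℕ s) (mod-trans (mod-reflexive (+-comm (toℕ s) (f s)))
    (mod-trans (constant s) (mod-sym (mod-trans (mod-reflexive (reach-c s)) (mod-multiple c (suc b))))))

Δ-double : ∀ q → Δ q + Δ q ≡ q * suc q
Δ-double zero    = refl
Δ-double (suc q) = begin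
  suc q + Δ q + (suc q + Δ q)        ≡⟨ regroup (suc q) (Δ q) ⟩
  suc q + suc q + (Δ q + Δ q)        ≡⟨ cong (suc q + suc q +_) (Δ-double q) ⟩
  suc q + suc q + q * suc q          ≡⟨ expand q ⟩
  suc q * suc (suc q)                ∎
  where
  open ≡-Reasoning
  regroup : ∀ a t → a + t + (a + t) ≡ a + a + (t + t)
  regroup = solve-∀
  expand : ∀ q → suc q + suc q + q * suc q ≡ suc q * suc (suc q)
  expand = solve-∀

Δ-scale : ∀ q → q * Δ (suc q) ≡ suc (suc q) * Δ q
Δ-scale q = begin
  q * (suc q + Δ q)          ≡⟨ *-distribˡ-+ q (suc q) (Δ q) ⟩
  q * suc q + q * Δ q        ≡⟨ cong (_+ q * Δ q) (Δ-double q) ⟨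
  Δ q + Δ q + q * Δ q        ≡⟨ collect q (Δ q) ⟩
  suc (suc q) * Δ q          ∎
  where
  open ≡-Reasoning
  collect : ∀ q t → t + t + q * t ≡ suc (suc q) * t
  collect = solve-∀

shift-cost : ∀ q → (Fin q → ℕ) → ℕ → ℕ
shift-cost q e s = s + ∑[ i < q ] ((e i + s) % suc (suc q))

module _ (q : ℕ) (e : Fin q → ℕ) where
  private
    N : ℕ
    N = suc (suc q)

  cost-class : ∀ s → shift-cost q e s + s ≡ sum e [mod N ]
  cost-class s = mod-trans (mod-+ (mod-+ (mod-refl {x = s}) (sum-% (λ i → e i + s))) (mod-refl {x = s}))
                (mod-trans (mod-reflexive total) (mod-multiple (sum e) s))
    where
    shifted : ∑[ i < q ] (e i + s) ≡ sum e + q * s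
    shifted = trans (∑-distrib-+ {q} e (λ _ → s)) (cong (sum e +_) (sum-const q s))
    regroup : ∀ s E q → s + (E + q * s) + s ≡ E + s * suc (suc q)
    regroup = solve-∀
    total : s + ∑[ i < q ] (e i + s) + s ≡ sum e + s * N
    total = trans (cong (λ x → s + x + s) shifted) (regroup s (sum e) q)

  cost-total : ∑[ s < N ] shift-cost q e (toℕ s) ≡ Δ (suc q) + q * Δ (suc q)
  cost-total = begin
    ∑[ s < N ] (toℕ s + ∑[ i < q ] residue i s)
      ≡⟨ ∑-distrib-+ {N} toℕ (λ s → ∑[ i < q ] residue i s) ⟩
    ∑[ s < N ] toℕ s + ∑[ s < N ] ∑[ i < q ] residue i s
      ≡⟨ cong₂ _+_ (sum-toℕ (suc q)) (∑-comm {N} {q} (λ s i → residue i s)) ⟩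
    Δ (suc q) + ∑[ i < q ] ∑[ s < N ] residue i s
      ≡⟨ cong (Δ (suc q) +_) (sum-cong-≗ {q} (λ i → shift-sum (suc q) (e i))) ⟩
    Δ (suc q) + ∑[ i < q ] Δ (suc q)
      ≡⟨ cong (Δ (suc q) +_) (sum-const q (Δ (suc q))) ⟩
    Δ (suc q) + q * Δ (suc q)
      ∎
    where
    open ≡-Reasoning
    residue : Fin q → Fin N → ℕ
    residue i s = (e i + toℕ s) % N

  -- Some shift costs at most Δ q: otherwise the N costs, lying in distinct residue classes,
  -- would add up to more than cost-total allows.
  good-shift : Σ ℕ λ s → shift-cost q e s ≤ Δ q
  good-shift with any? (λ s → shift-cost q e (toℕ s) ≤? Δ q)
  ... | yes (s , cheap) = toℕ s , cheap
  ... | no  none        = contradiction (*-cancelˡ-≤ N too-much) 1+n≰n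
    where
    expensive : ∀ s → suc (Δ q) ≤ shift-cost q e (toℕ s)
    expensive s = ≰⇒> (λ cheap → none (s , cheap))
    total : ∑[ s < N ] shift-cost q e (toℕ s) ≡ N * Δ q + Δ (suc q)
    total = trans cost-total (trans (+-comm (Δ (suc q)) _) (cong (_+ Δ (suc q)) (Δ-scale q)))
    too-much : N * suc (Δ q) ≤ N * Δ q
    too-much = +-cancelʳ-≤ (Δ (suc q)) _ _ (subst (N * suc (Δ q) + Δ (suc q) ≤_) total
      (residue-sum-bound (suc q) (λ s → shift-cost q e (toℕ s)) (sum e) (suc (Δ q)) (λ s → cost-class (toℕ s)) expensive))

consecutive-residues : ∀ n y → (y + n) % suc n + y % suc n ≤ y + n
consecutive-residues n y with y % suc n in eq
... | zero  = begin
  (y + n) % suc n + 0  ≡⟨ +-identityʳ _ ⟩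
  (y + n) % suc n      ≡⟨ mod-small (n<1+n n) (mod-+ (mod-trans (mod-sym (mod-% y)) (mod-reflexive eq)) (mod-refl {x = n})) ⟩
  n                    ≤⟨ m≤n+m n y ⟩
  y + n                ∎
  where open ≤-Reasoning
... | suc r = begin
  (y + n) % suc n + suc r  ≡⟨ cong (_+ suc r) (mod-small r<N wraps) ⟩
  r + suc r                ≡⟨ +-comm r (suc r) ⟩
  suc r + r                ≤⟨ +-mono-≤ (subst (_≤ y) eq (m%n≤m y (suc n))) r≤n ⟩
  y + n                    ∎
  where
  open ≤-Reasoning
  r≤n : r ≤ n
  r≤n = <⇒≤ (s≤s⁻¹ (subst (_< suc n) eq (m%n<n y (suc n))))
  r<N : r < suc n
  r<N = s≤s r≤n
  wraps : y + n ≡ r [mod suc n ]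
  wraps = mod-trans (mod-+ (mod-trans (mod-sym (mod-% y)) (mod-reflexive eq)) (mod-refl {x = n}))
    (mod-trans (mod-reflexive (sym (+-suc r n))) (congruent ([m+n]%n≡m%n r (suc n))))

-- Dropping the last two terms of a full period of residues of J + t, J ≥ 1,
-- loses at most J + q.
partial-shift-bound : ∀ q y → Δ (suc q) ≤ ∑[ i < q ] ((suc y + toℕ i) % suc (suc q)) + suc y + q
partial-shift-bound q y = begin
  Δ (suc q)                                ≡⟨ shift-sum (suc q) (suc y) ⟨
  ∑[ t < suc (suc q) ] h (toℕ t)           ≡⟨ trans (sum-last (suc q) h) (cong (_+ h (suc q)) (sum-last q h)) ⟩
  S + h q + h (suc q)                      ≡⟨ +-assoc S (h q) (h (suc q)) ⟩
  S + (h q + h (suc q))                    ≡⟨ cong (λ x → S + (x + h (suc q))) (cong (_% N) (sym (+-suc y q))) ⟩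
  S + ((y + suc q) % N + h (suc q))        ≡⟨ cong (λ x → S + ((y + suc q) % N + x)) last-term ⟩
  S + ((y + suc q) % N + y % N)            ≤⟨ +-monoʳ-≤ S (consecutive-residues (suc q) y) ⟩
  S + (y + suc q)                          ≡⟨ regroup S y q ⟩
  S + suc y + q                            ∎
  where
  open ≤-Reasoning
  N = suc (suc q)
  h : ℕ → ℕ
  h t = (suc y + t) % N
  S = ∑[ i < q ] h (toℕ i)
  last-term : h (suc q) ≡ y % N
  last-term = trans (cong (_% N) (sym (+-suc y (suc q)))) ([m+n]%n≡m%n y N)
  regroup : ∀ S y q → S + (y + suc q) ≡ S + suc y + q
  regroup = solve-∀

module Diameter (q m′ : ℕ) where
  n N m M D : ℕ
  n = suc q
  N = suc n
  m = suc m′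
  M = m * N
  D = Δ n * m ∸ n

  open Walks q m′

  D-split : D ≡ m′ + (q * m′ + m * Δ q)
  D-split = trans (cong (_∸ n) (expand q m′ (Δ q))) (m+n∸m≡n n _)
    where
    expand : ∀ q m′ t → (suc q + t) * suc m′ ≡ suc q + (m′ + (q * m′ + suc m′ * t))
    expand = solve-∀

  -- Given K ≥ q (m − 1) + m Δ q and targets t, walk back from K by a multiple of m
  -- to a length k admitting a ≥ 0 with ∑ a ≤ k and k + aⱼ ≡ tⱼ (mod M).
  module Spread (K : ℕ) (t : Fin q → ℕ) where
    -- w j ≡ t j − K (mod M), split as c j + e j * m with c j < m.
    w c e : Fin q → ℕ
    w j = (t j + K * pred M) % M
    c j = w j % m
    e j = w j / m

    K+w : ∀ j → K + w j ≡ t j [mod M ]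
    K+w j = mod-trans (mod-+ (mod-refl {x = K}) (mod-% (t j + K * pred M))) (undo-shift (pred M) K (t j))

    -- The cheapest shift s moves m s from the length into every coordinate.
    s : ℕ
    s = proj₁ (good-shift q e)

    a : Fin q → ℕ
    a j = c j + m * ((e j + s) % N)

    k : ℕ
    k = K ∸ m * s

    spent : m * s + sum a ≡ sum c + m * shift-cost q e s
    spent = begin
      m * s + sum a                          ≡⟨ cong (m * s +_) (∑-distrib-+ {q} c (λ j → m * ((e j + s) % N))) ⟩
      m * s + (sum c + sum (λ j → m * ((e j + s) % N)))
                                             ≡⟨ cong (λ x → m * s + (sum c + x)) (*-distribˡ-sum m (λ j → (e j + s) % N)) ⟨
      m * s + (sum c + m * R)                ≡⟨ regroup m s (sum c) R ⟩
      sum c + m * (s + R)                    ∎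
      where
      open ≡-Reasoning
      R = ∑[ j < q ] ((e j + s) % N)
      regroup : ∀ m s C R → m * s + (C + m * R) ≡ C + m * (s + R)
      regroup = solve-∀

    -- Because c j < m and s is a good shift.
    spent≤ : m * s + sum a ≤ q * m′ + m * Δ q
    spent≤ = subst (_≤ q * m′ + m * Δ q) (sym spent)
      (+-mono-≤ (≤-trans (sum-mono (λ j → s≤s⁻¹ (m%n<n (w j) m))) (≤-reflexive (sum-const q m′)))
                (*-monoʳ-≤ m (proj₂ (good-shift q e))))

    arrival : ∀ j → K ≡ k + m * s → k + a j ≡ t j [mod M ]
    arrival j K≡ = begin
      k + (c j + m * ((e j + s) % N))     ≈⟨ mod-+ (mod-refl {x = k}) (mod-+ (mod-refl {x = c j}) (scaled-residue m′ n (e j + s))) ⟩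
      k + (c j + m * (e j + s))           ≡⟨ regroup k (c j) m (e j) s ⟩
      k + m * s + (c j + e j * m)         ≡⟨ cong₂ _+_ (sym K≡) (sym (m≡m%n+[m/n]*n (w j) m)) ⟩
      K + w j                             ≈⟨ K+w j ⟩
      t j                                 ∎
      where
      open ≡-mod-Reasoning M
      regroup : ∀ k c m e s → k + (c + m * (e + s)) ≡ k + m * s + (c + e * m)
      regroup = solve-∀

  spread : ∀ K (t : Fin q → ℕ) → q * m′ + m * Δ q ≤ K →
           Σ ℕ λ k → Σ (Fin q → ℕ) λ a → k ≤ K × k ≡ K [mod m ] × sum a ≤ k × (∀ j → k + a j ≡ t j [mod M ])
  spread K t large = k , a , m∸n≤m K (m * s) , mod-sym (mod-trans (mod-reflexive K≡) k+ms≡k) , sum≤k , λ j → arrival j K≡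
    where
    open Spread K t
    ms+a≤K : m * s + sum a ≤ K
    ms+a≤K = ≤-trans spent≤ large
    K≡ : K ≡ k + m * s
    K≡ = sym (m∸n+n≡m (≤-trans (m≤m+n (m * s) (sum a)) ms+a≤K))
    sum≤k : sum a ≤ k
    sum≤k = m+n≤o⇒m≤o∸n (sum a) (subst (_≤ K) (+-comm (m * s) (sum a)) ms+a≤K)
    k+ms≡k : k + m * s ≡ k [mod m ]
    k+ms≡k = mod-trans (mod-reflexive (cong (k +_) (*-comm m s))) (mod-multiple k s)

  m′≤D : m′ ≤ D
  m′≤D = subst (m′ ≤_) (sym D-split) (m≤m+n m′ _)

  -- K ≥ D − m′ leaves room for the total m s + ∑ a spent in Spread.
  large : ∀ K → D ≤ K + m′ → q * m′ + m * Δ q ≤ K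
  large K D≤K+m′ = +-cancelˡ-≤ m′ (q * m′ + m * Δ q) K (subst₂ _≤_ D-split (+-comm K m′) D≤K+m′)

  solvable : ∀ x (t : Fin q → ℕ) →
    Σ ℕ λ k → Σ (Fin q → ℕ) λ a → k ≤ D × sum a ≤ k × k ≡ x [mod m ] × (∀ j → k + a j ≡ t j [mod M ])
  solvable x t =
    let K , K≤D , D≤K+m′ , K≡x = top-representative m′ D x m′≤D
        k , a , k≤K , k≡K , sum≤k , hits = spread K t (large K D≤K+m′)
    in  k , a , ≤-trans k≤K K≤D , sum≤k , mod-trans k≡K K≡x , hits

  targets-reach : ∀ u v {k a} → k ≡ toℕ (proj₁ v) + toℕ (proj₁ u) * m′ [mod m ] →
    (∀ j → k + a j ≡ coord v j + coord u j * pred M [mod M ]) → Reaches u v k a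
  targets-reach (u₀ , us) (v₀ , vs) k≡ hits = reaches
    (mod-trans (mod-+ (mod-refl {x = toℕ u₀}) k≡) (undo-shift m′ (toℕ u₀) (toℕ v₀)))
    (λ j → mod-trans (mod-+ (mod-refl {x = coord (u₀ , us) j}) (hits j)) (undo-shift (pred M) (coord (u₀ , us) j) (coord (v₀ , vs) j)))

  upper : (u v : Γ n m) → Σ ℕ λ k → k ≤ D × Walk n m u v k
  upper u v =
    let k , a , k≤D , sum≤k , k≡ , hits = solvable (toℕ (proj₁ v) + toℕ (proj₁ u) * m′) (λ j → coord v j + coord u j * pred M)
    in  k , k≤D , reaches-walk k a sum≤k (targets-reach u v k≡ hits)

  u* v* : Γ n m
  u* = fzero , tabulate (λ _ → fzero)
  v* = D mod m , tabulate (λ j → (D + m * toℕ j + m′) mod M)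

  -- A shorter walk would fall short of v* by J ≥ 1 multiples of m in the first coordinate.
  no-short-walk : ∀ k (a : Fin q → ℕ) y → sum a ≤ k → D ≡ k + suc y * m →
    (∀ j → k + a j ≡ D + m * toℕ j + m′ [mod M ]) → ⊥
  no-short-walk k a y sum≤k D≡ hits = 1+n≰n (≤-trans exceeds S+G≤Δ)
    where
    G = suc y
    r : Fin q → ℕ
    r j = (G + toℕ j) % N
    S = sum r
    class : ∀ j → a j ≡ m * r j + m′ [mod M ]
    class j = mod-cancelˡ k (begin
      k + a j                          ≈⟨ hits j ⟩
      D + m * toℕ j + m′               ≡⟨ cong (λ d → d + m * toℕ j + m′) D≡ ⟩
      k + G * m + m * toℕ j + m′       ≡⟨ regroup k G m (toℕ j) m′ ⟩
      k + (m * (G + toℕ j) + m′)       ≈⟨ mod-+ (mod-refl {x = k}) (mod-+ (scaled-residue m′ n (G + toℕ j)) (mod-refl {x = m′})) ⟨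
      k + (m * r j + m′)               ∎)
      where
      open ≡-mod-Reasoning M
      regroup : ∀ k G m i m′ → k + G * m + m * i + m′ ≡ k + (m * (G + i) + m′)
      regroup = solve-∀
    below-M : ∀ j → m * r j + m′ < M
    below-M j = begin-strict
      m * r j + m′      <⟨ +-monoʳ-< (m * r j) (n<1+n m′) ⟩
      m * r j + m       ≡⟨ trans (+-comm (m * r j) m) (sym (*-suc m (r j))) ⟩
      m * suc (r j)     ≤⟨ *-monoʳ-≤ m (m%n<n (G + toℕ j) N) ⟩
      M                 ∎
      where open ≤-Reasoning
    floor : ∀ j → m * r j + m′ ≤ a j
    floor j = subst (_≤ a j) (mod-small (below-M j) (class j)) (m%n≤m (a j) M)
    total : m * (S + G) + q * m′ ≤ m′ + (q * m′ + m * Δ q)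
    total = begin
      m * (S + G) + q * m′             ≡⟨ regroup m S G q m′ ⟩
      (m * S + q * m′) + G * m         ≡⟨ cong₂ (λ x y → x + y + G * m) (*-distribˡ-sum m r) (sym (sum-const q m′)) ⟩
      sum (λ j → m * r j) + ∑[ j < q ] m′ + G * m   ≡⟨ cong (_+ G * m) (∑-distrib-+ {q} (λ j → m * r j) (λ _ → m′)) ⟨
      ∑[ j < q ] (m * r j + m′) + G * m   ≤⟨ +-monoˡ-≤ (G * m) (≤-trans (sum-mono floor) sum≤k) ⟩
      k + G * m                        ≡⟨ trans (sym D≡) D-split ⟩
      m′ + (q * m′ + m * Δ q)          ∎
      where
      open ≤-Reasoning
      regroup : ∀ m S G q m′ → m * (S + G) + q * m′ ≡ m * S + q * m′ + G * m
      regroup = solve-∀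
    exceeds : suc (Δ q) ≤ S + G
    exceeds = +-cancelʳ-≤ q _ _ (subst (_≤ S + G + q) (cong suc (+-comm q (Δ q))) (partial-shift-bound q y))
    S+G≤Δ : S + G ≤ Δ q
    S+G≤Δ = cancel-remainder m′ (S + G) (Δ q)
      (+-cancelʳ-≤ (q * m′) _ _ (subst (m * (S + G) + q * m′ ≤_) (regroup m′ q (m * Δ q)) total))
      where
      regroup : ∀ m′ q x → m′ + (q * m′ + x) ≡ m′ + x + q * m′
      regroup = solve-∀

  lower-arith : ∀ k (a : Fin q → ℕ) → sum a ≤ k → k ≡ D [mod m ] →
    (∀ j → k + a j ≡ D + m * toℕ j + m′ [mod M ]) → D ≤ k
  lower-arith k a sum≤k k≡D hits = ≮⇒≥ short
    where
    short : k < D → ⊥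
    short k<D with class-gap m′ (<⇒≤ k<D) k≡D
    ... | zero  , D≡ = <-irrefl (sym (trans D≡ (+-identityʳ k))) k<D
    ... | suc y , D≡ = no-short-walk k a y sum≤k D≡ hits

  at-v* : ∀ j {x} → coord u* j + x ≡ coord v* j [mod M ] → x ≡ D + m * toℕ j + m′ [mod M ]
  at-v* j {x} h = begin
    x                                              ≡⟨ cong (λ z → toℕ z + x) (lookup∘tabulate _ j) ⟨
    coord u* j + x                                 ≈⟨ h ⟩
    toℕ (lookup (proj₂ v*) j)                      ≡⟨ cong toℕ (lookup∘tabulate _ j) ⟩
    toℕ ((D + m * toℕ j + m′) mod M)               ≈⟨ toℕ-mod _ ⟩
    D + m * toℕ j + m′                             ∎
    where open ≡-mod-Reasoning M

  lower : ∀ k → Walk n m u* v* k → D ≤ k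
  lower k walk =
    let a , sum≤k , reaches h₀ h = walk-reaches walk
    in  lower-arith k a sum≤k (mod-trans h₀ (toℕ-mod D)) (λ j → at-v* j (h j))

mainTheorem4 : (n m : ℕ) → 2 ≤ n → 1 ≤ m →
    HasDiameter n m ((suc n C 2) * m ∸ n)
mainTheorem4 zero    _        () _
mainTheorem4 (suc q) zero     _  ()
mainTheorem4 (suc q) (suc m′) _  _ =
  subst (λ T → HasDiameter (suc q) (suc m′) (T * suc m′ ∸ suc q)) (sym (Δ≡C (suc q)))
    (upper , u* , v* , lower)
  where open Diameter q m′
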